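{- For every integer $n\ge 7$, $3\le \dim_{ms}(P_n\boxtimes P_n)\le 4$.
   Context: $P_n$ is the path on $n$ vertices. The strong product $G\boxtimes H$ has vertex set $V(G)\times V(H)$, with $(g,h)$ and $(g',h')$ adjacent iff ($g=g'$ and $hh'\in E(H)$) or ($gg'\in E(G)$ and $h=h'$) or ($gg'\in E(G)$ and $hh'\in E(H)$). For a connected graph $G$ with distance $d_G$, $u\in V(G)$ and $W=\{w_1,\dots,w_t\}\subseteq V(G)$, $\mathrm{m}_G(u|W)=\{\!\{d_G(u,w_1),\dots,d_G(u,w_t)\}\!\}$ (a multiset). $W$ is a multiset resolving set if the multisets $\mathrm{m}_G(u|W)$, $u\in V(G)$, are pairwise distinct; $\dim_{ms}(G)$ is the minimum cardinality of a multiset resolving set ($\infty$ if none exists). -}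

module Defs where

open import Level using (Level)
open import Data.Nat using (ℕ; zero; suc; _≤_)
open import Data.Fin using (Fin; toℕ)
open import Data.Product using (_×_; Σ; _,_)
open import Data.Sum using (_⊎_)
open import Data.List using (List; length)
open import Data.List.Relation.Unary.Unique.Propositional using (Unique)
open import Data.List.Relation.Binary.Pointwise using (Pointwise)
open import Data.List.Relation.Binary.Permutation.Propositional using (_↭_)
open import Relation.Binary.PropositionalEquality using (_≡_)

data Walk {V : Set} (E : V → V → Set) : V → V → ℕ → Set where
  here : ∀ {u} → Walk E u u zero
  step : ∀ {u w v k} → E u w → Walk E w v k → Walk E u v (suc k)

IsDist : {V : Set} → (V → V → Set) → V → V → ℕ → Set
IsDist E u v k = Walk E u v k × (∀ m → Walk E u v m → k ≤ m)

PathAdj : (n : ℕ) → Fin n → Fin n → Set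
PathAdj n i j = (suc (toℕ i) ≡ toℕ j) ⊎ (suc (toℕ j) ≡ toℕ i)

StrongAdj : {A B : Set} → (A → A → Set) → (B → B → Set) → A × B → A × B → Set
StrongAdj EG EH (g , h) (g' , h') =
  ((g ≡ g') × EH h h') ⊎ ((EG g g' × h ≡ h') ⊎ (EG g g' × EH h h'))

PnPn : (n : ℕ) → Fin n × Fin n → Fin n × Fin n → Set
PnPn n = StrongAdj (PathAdj n) (PathAdj n)

DistList : {V : Set} → (V → V → Set) → V → List V → List ℕ → Set
DistList E u W ds = Pointwise (IsDist E u) W ds

-- W (a list without repetitions, i.e. a set) is a multiset resolving set:
-- equal multisets of distances (lists equal up to permutation) force u ≡ v.
MultisetResolving : {V : Set} → (V → V → Set) → List V → Set
MultisetResolving E W =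
  Unique W ×
  (∀ u v ds es → DistList E u W ds → DistList E v W es → ds ↭ es → u ≡ v)

DimMsAtLeast : {V : Set} → (V → V → Set) → ℕ → Set
DimMsAtLeast E k = ∀ W → MultisetResolving E W → k ≤ length W

DimMsAtMost : {V : Set} → (V → V → Set) → ℕ → Set
DimMsAtMost E k = Σ (List _) λ W → MultisetResolving E W × (length W ≤ k)

{-# OPTIONS --safe #-}
module Submission where

-- In P_n ⊠ P_n the distance is the Chebyshev distance max(|i - k|, |j - l|), realised by walking diagonally.
-- One landmark takes at most n distance values, and two distinct landmarks at most n² - 1 ordered pairs
-- (never (0, 0)), so neither separates the n² vertices, even with ordered distance lists.
-- For the upper bound write n = N + 1 and take the corners (0, N), (N, 0) together with (0, 0), (0, 1) when n
-- is odd, resp. (0, 1), (1, 1) when n is even. The sorted list of the four distances of (x, y) determines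
-- (x, y): which entries coincide reveals the region of the grid (x + y ≥ N or not, x ≤ y or not, 2x ≤ N or
-- not), each region has its own way of reading x and y off, and the parity of N rules out the coincidences
-- that would be ambiguous.

open import Defs
open import Data.Bool using (true; false; if_then_else_; _∧_)
open import Data.Bool.Properties using (∧-zeroʳ)
open import Data.Empty using (⊥-elim)
open import Data.Fin using (Fin; zero; suc; toℕ; fromℕ; inject₁; fromℕ<; remQuot; combine)
open import Data.Fin.Properties
  using (toℕ-inject₁; toℕ-injective; toℕ<n; toℕ≤pred[n]; toℕ-fromℕ; fromℕ<-injective; *↔×; combine-injective;
         punchOut-injective; <⇒notInjective)
  renaming (_≟_ to _≟ᶠ_)
open import Data.List using (List; []; _∷_; map)
open import Data.List.Relation.Binary.Pointwise using ([]; _∷_; Pointwise-≡⇒≡)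
open import Data.List.Relation.Binary.Permutation.Propositional
  using (_↭_; ↭-refl; ↭-reflexive; ↭-prep; ↭-swap; ↭-trans; ↭-sym; ↭⇒↭ₛ)
open import Data.List.Relation.Unary.All using ([]; _∷_)
open import Data.List.Relation.Unary.AllPairs using ([]; _∷_)
open import Data.List.Relation.Unary.Linked using ([]; [-]; _∷_)
open import Data.List.Relation.Unary.Unique.Propositional using (Unique)
open import Data.Nat
  using (ℕ; zero; suc; _≤_; _<_; z≤n; s≤s; s≤s⁻¹; _⊔_; _∸_; ∣_-_∣; _+_; _*_; _≡ᵇ_; _≤ᵇ_; _≤?_; _<?_)
open import Data.Nat.Properties
open import Data.List.Relation.Unary.Sorted.TotalOrder ≤-totalOrder using (Sorted)
open import Data.List.Relation.Unary.Sorted.TotalOrder.Properties using (↗↭↗⇒≋)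
open import Data.Product using (_×_; _,_; proj₁; proj₂; Σ)
open import Data.Sum using (_⊎_; inj₁; inj₂)
open import Function.Base using (_∘_)
open import Function.Bundles using (Injection)
open import Function.Definitions using (Injective)
open import Function.Properties.Inverse using (↔⇒↣)
open import Relation.Binary.Definitions using (tri<; tri≈; tri>)
open import Relation.Binary.PropositionalEquality
open import Relation.Nullary using (¬_; yes; no)
open import Relation.Nullary.Decidable using (dec-true; dec-false)

Grid : (m n : ℕ) → Fin m × Fin n → Fin m × Fin n → Set
Grid m n = StrongAdj (PathAdj m) (PathAdj n)

chebyshev : ∀ {m n} → Fin m × Fin n → Fin m × Fin n → ℕ
chebyshev (i , j) (k , l) = ∣ toℕ i - toℕ k ∣ ⊔ ∣ toℕ j - toℕ l ∣

chebyshev-self : ∀ {m n} (u : Fin m × Fin n) → chebyshev u u ≡ 0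
chebyshev-self (i , j) = cong₂ _⊔_ (∣n-n∣≡0 (toℕ i)) (∣n-n∣≡0 (toℕ j))

chebyshev≡0⇒≡ : ∀ {m n} {u v : Fin m × Fin n} → chebyshev u v ≡ 0 → u ≡ v
chebyshev≡0⇒≡ {u = i , j} {k , l} d≡0 = cong₂ _,_ (coordinate≡ (m≤m⊔n _ _)) (coordinate≡ (m≤n⊔m _ _))
  where
  coordinate≡ : ∀ {n} {a b : Fin n} → ∣ toℕ a - toℕ b ∣ ≤ chebyshev (i , j) (k , l) → a ≡ b
  coordinate≡ le = toℕ-injective (∣m-n∣≡0⇒m≡n (n≤0⇒n≡0 (subst (_ ≤_) d≡0 le)))

∣n-1+n∣≡1 : ∀ n → ∣ n - suc n ∣ ≡ 1
∣n-1+n∣≡1 zero    = refl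
∣n-1+n∣≡1 (suc n) = ∣n-1+n∣≡1 n

pathAdj⇒∣-∣≤1 : ∀ {n} {i j : Fin n} → PathAdj n i j → ∣ toℕ i - toℕ j ∣ ≤ 1
pathAdj⇒∣-∣≤1 {i = i} (inj₁ e) = ≤-reflexive (trans (cong (∣ toℕ i -_∣) (sym e)) (∣n-1+n∣≡1 (toℕ i)))
pathAdj⇒∣-∣≤1 {j = j} (inj₂ e) = ≤-reflexive
  (trans (cong (∣_- toℕ j ∣) (sym e)) (trans (∣-∣-comm (suc (toℕ j)) (toℕ j)) (∣n-1+n∣≡1 (toℕ j))))

≡⇒∣-∣≤1 : ∀ {n} {i j : Fin n} → i ≡ j → ∣ toℕ i - toℕ j ∣ ≤ 1
≡⇒∣-∣≤1 {i = i} refl = subst (_≤ 1) (sym (∣n-n∣≡0 (toℕ i))) z≤n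

grid-adj⇒∣-∣≤1 : ∀ {m n} {i k : Fin m} {j l : Fin n} → Grid m n (i , j) (k , l) →
                 ∣ toℕ i - toℕ k ∣ ≤ 1 × ∣ toℕ j - toℕ l ∣ ≤ 1
grid-adj⇒∣-∣≤1 (inj₁ (i≡k , j~l))        = ≡⇒∣-∣≤1 i≡k , pathAdj⇒∣-∣≤1 j~l
grid-adj⇒∣-∣≤1 (inj₂ (inj₁ (i~k , j≡l))) = pathAdj⇒∣-∣≤1 i~k , ≡⇒∣-∣≤1 j≡l
grid-adj⇒∣-∣≤1 (inj₂ (inj₂ (i~k , j~l))) = pathAdj⇒∣-∣≤1 i~k , pathAdj⇒∣-∣≤1 j~l

chebyshev-adj : ∀ {m n} {u w : Fin m × Fin n} (v : Fin m × Fin n) → Grid m n u w →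
                chebyshev u v ≤ suc (chebyshev w v)
chebyshev-adj {u = i , j} {k , l} (a , b) u~w with grid-adj⇒∣-∣≤1 u~w
... | ik≤1 , jl≤1 =
  ⊔-lub (≤-trans (triangle (toℕ i) (toℕ k) (toℕ a) ik≤1) (s≤s (m≤m⊔n _ _)))
        (≤-trans (triangle (toℕ j) (toℕ l) (toℕ b) jl≤1) (s≤s (m≤n⊔m _ _)))
  where
  triangle : ∀ x y z → ∣ x - y ∣ ≤ 1 → ∣ x - z ∣ ≤ suc ∣ y - z ∣
  triangle x y z xy≤1 = ≤-trans (∣-∣-triangle x y z) (+-monoˡ-≤ ∣ y - z ∣ xy≤1)

chebyshev≤length : ∀ {m n} {u v : Fin m × Fin n} {k} → Walk (Grid m n) u v k → chebyshev u v ≤ k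
chebyshev≤length {u = u} here    = ≤-reflexive (chebyshev-self u)
chebyshev≤length {v = v} (step u~w w⇝v) = ≤-trans (chebyshev-adj v u~w) (s≤s (chebyshev≤length w⇝v))

stepTowards : ∀ {n} → Fin n → Fin n → Fin n
stepTowards zero    zero    = zero
stepTowards {suc (suc _)} zero (suc _) = suc zero
stepTowards (suc a) zero    = inject₁ a
stepTowards (suc a) (suc b) = suc (stepTowards a b)

stepTowards-self : ∀ {n} (a : Fin n) → stepTowards a a ≡ a
stepTowards-self zero    = refl
stepTowards-self (suc a) = cong suc (stepTowards-self a)

stepTowards-adj : ∀ {n} {a b : Fin n} → a ≢ b → PathAdj n a (stepTowards a b)
stepTowards-adj {a = zero}  {zero}  a≢b = ⊥-elim (a≢b refl)
stepTowards-adj {suc (suc _)} {zero} {suc b} _ = inj₁ refl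
stepTowards-adj {a = suc a} {zero}  _   = inj₂ (cong suc (toℕ-inject₁ a))
stepTowards-adj {a = suc a} {suc b} a≢b with stepTowards-adj (a≢b ∘ cong suc)
... | inj₁ e = inj₁ (cong suc e)
... | inj₂ e = inj₂ (cong suc e)

∣stepTowards-∣ : ∀ {n} (a b : Fin n) → ∣ toℕ (stepTowards a b) - toℕ b ∣ ≡ ∣ toℕ a - toℕ b ∣ ∸ 1
∣stepTowards-∣ zero    zero    = refl
∣stepTowards-∣ {suc (suc _)} zero (suc b) = refl
∣stepTowards-∣ (suc a) zero    = trans (∣-∣-identityʳ (toℕ (inject₁ a))) (toℕ-inject₁ a)
∣stepTowards-∣ (suc a) (suc b) = ∣stepTowards-∣ a b

towards : ∀ {m n} → Fin m × Fin n → Fin m × Fin n → Fin m × Fin n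
towards (i , j) (k , l) = stepTowards i k , stepTowards j l

towards-adj : ∀ {m n} {u v : Fin m × Fin n} → u ≢ v → Grid m n u (towards u v)
towards-adj {u = i , j} {k , l} u≢v with i ≟ᶠ k | j ≟ᶠ l
... | yes refl | yes refl = ⊥-elim (u≢v refl)
... | yes refl | no j≢l   = inj₁ (sym (stepTowards-self i) , stepTowards-adj j≢l)
... | no i≢k   | yes refl = inj₂ (inj₁ (stepTowards-adj i≢k , sym (stepTowards-self j)))
... | no i≢k   | no j≢l   = inj₂ (inj₂ (stepTowards-adj i≢k , stepTowards-adj j≢l))

chebyshev-towards : ∀ {m n} (u v : Fin m × Fin n) → chebyshev (towards u v) v ≡ chebyshev u v ∸ 1
chebyshev-towards (i , j) (k , l) =
  trans (cong₂ _⊔_ (∣stepTowards-∣ i k) (∣stepTowards-∣ j l))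
        (sym (∸-distribʳ-⊔ 1 ∣ toℕ i - toℕ k ∣ ∣ toℕ j - toℕ l ∣))

walkOfChebyshev : ∀ {m n} k {u v : Fin m × Fin n} → chebyshev u v ≡ k → Walk (Grid m n) u v k
walkOfChebyshev zero {u} d≡0 with refl ← chebyshev≡0⇒≡ {u = u} d≡0 = here
walkOfChebyshev (suc k) {u} {v} d≡1+k =
  step (towards-adj u≢v) (walkOfChebyshev k (trans (chebyshev-towards u v) (cong (_∸ 1) d≡1+k)))
  where
  u≢v : u ≢ v
  u≢v refl = 0≢1+n (trans (sym (chebyshev-self u)) d≡1+k)

isDist-chebyshev : ∀ {m n} (u v : Fin m × Fin n) → IsDist (Grid m n) u v (chebyshev u v)
isDist-chebyshev u v = walkOfChebyshev _ refl , λ _ → chebyshev≤length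

isDist⇒≡chebyshev : ∀ {m n} {u v : Fin m × Fin n} {k} → IsDist (Grid m n) u v k → k ≡ chebyshev u v
isDist⇒≡chebyshev (u⇝v , minimal) = ≤-antisym (minimal _ (walkOfChebyshev _ refl)) (chebyshev≤length u⇝v)

distList⇒≡map : ∀ {m n} {u : Fin m × Fin n} {W ds} → DistList (Grid m n) u W ds → ds ≡ map (chebyshev u) W
distList⇒≡map []       = refl
distList⇒≡map (d ∷ ds) = cong₂ _∷_ (isDist⇒≡chebyshev d) (distList⇒≡map ds)

distList-chebyshev : ∀ {m n} (u : Fin m × Fin n) W → DistList (Grid m n) u W (map (chebyshev u) W)
distList-chebyshev u []      = []
distList-chebyshev u (w ∷ W) = isDist-chebyshev u w ∷ distList-chebyshev u W

resolving⇒injective : ∀ {m n} {W} → MultisetResolving (Grid m n) W →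
                      ∀ u v → map (chebyshev u) W ≡ map (chebyshev v) W → u ≡ v
resolving⇒injective {W = W} (_ , resolves) u v eq =
  resolves u v _ _ (distList-chebyshev u W) (distList-chebyshev v W) (↭-reflexive eq)

avoiding⇒notInjective : ∀ {n} {f : Fin (suc n) → Fin (suc n)} k → (∀ i → f i ≢ k) → ¬ Injective _≡_ _≡_ f
avoiding⇒notInjective {f = f} k avoids f-injective =
  <⇒notInjective (n<1+n _) λ {i} {j} eq → f-injective (punchOut-injective (avoids i ∘ sym) (avoids j ∘ sym) eq)

module _ {n : ℕ} where

  vertex : Fin (n * n) → Fin n × Fin n
  vertex = remQuot n

  vertex-injective : Injective _≡_ _≡_ vertex
  vertex-injective = Injection.injective (↔⇒↣ *↔×)

  chebyshev<n : (u v : Fin n × Fin n) → chebyshev u v < n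
  chebyshev<n (i , j) (k , l) = ⊔-lub (coordinate i k) (coordinate j l)
    where
    coordinate : (a b : Fin n) → ∣ toℕ a - toℕ b ∣ < n
    coordinate a b = ≤-<-trans (∣m-n∣≤m⊔n (toℕ a) (toℕ b)) (⊔-lub (toℕ<n a) (toℕ<n b))

  distanceIndex : Fin n × Fin n → Fin n × Fin n → Fin n
  distanceIndex u w = fromℕ< (chebyshev<n u w)

  distanceIndex≡⇒chebyshev≡ : ∀ u v {w} → distanceIndex u w ≡ distanceIndex v w → chebyshev u w ≡ chebyshev v w
  distanceIndex≡⇒chebyshev≡ _ _ = fromℕ<-injective _ _ _ _

module _ (m : ℕ) where

  private
    n : ℕ
    n = suc (suc m)

  singleton-notResolving : ∀ w → ¬ MultisetResolving (Grid n n) (w ∷ [])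
  singleton-notResolving w resolving = <⇒notInjective (m<m*n n n (s≤s (s≤s z≤n))) index-injective
    where
    index : Fin (n * n) → Fin n
    index i = distanceIndex (vertex i) w
    index-injective : Injective _≡_ _≡_ index
    index-injective {i} {j} eq = vertex-injective
      (resolving⇒injective resolving _ _ (cong (_∷ []) (distanceIndex≡⇒chebyshev≡ (vertex i) (vertex j) eq)))

  pair-notResolving : ∀ w₁ w₂ → w₁ ≢ w₂ → ¬ MultisetResolving (Grid n n) (w₁ ∷ w₂ ∷ [])
  pair-notResolving w₁ w₂ w₁≢w₂ resolving = avoiding⇒notInjective zero code≢0 code-injective
    where
    code : Fin (n * n) → Fin (n * n)
    code i = combine {n} {n} (distanceIndex (vertex i) w₁) (distanceIndex (vertex i) w₂)
    code≢0 : ∀ i → code i ≢ zero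
    code≢0 i eq with combine-injective {n} {n} _ _ zero zero eq
    ... | e₁ , e₂ = w₁≢w₂ (trans (sym (at-distance-0 e₁)) (at-distance-0 e₂))
      where
      at-distance-0 : ∀ {w} → distanceIndex (vertex i) w ≡ zero → vertex i ≡ w
      at-distance-0 e = chebyshev≡0⇒≡ (fromℕ<-injective _ 0 _ (s≤s z≤n) e)
    code-injective : Injective _≡_ _≡_ code
    code-injective {i} {j} eq with combine-injective {n} {n} _ _ _ _ eq
    ... | e₁ , e₂ = vertex-injective (resolving⇒injective resolving _ _ (cong₂ (λ d₁ d₂ → d₁ ∷ d₂ ∷ [])
          (distanceIndex≡⇒chebyshev≡ (vertex i) (vertex j) e₁) (distanceIndex≡⇒chebyshev≡ (vertex i) (vertex j) e₂)))

dimMs≥3 : ∀ {n} → 2 ≤ n → DimMsAtLeast (PnPn n) 3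
dimMs≥3 {suc (suc m)} (s≤s (s≤s z≤n)) [] resolving with resolving⇒injective resolving (zero , zero) (zero , suc zero) refl
... | ()
dimMs≥3 {suc (suc m)} (s≤s (s≤s z≤n)) (w ∷ [])       resolving = ⊥-elim (singleton-notResolving m w resolving)
dimMs≥3 {suc (suc m)} (s≤s (s≤s z≤n)) (w₁ ∷ w₂ ∷ []) resolving@((w₁≢w₂ ∷ []) ∷ _ , _) =
  ⊥-elim (pair-notResolving m w₁ w₂ w₁≢w₂ resolving)
dimMs≥3 {suc (suc m)} (s≤s (s≤s z≤n)) (_ ∷ _ ∷ _ ∷ _) _ = s≤s (s≤s (s≤s z≤n))

DecodesTo : (List ℕ → ℕ × ℕ) → List ℕ → ℕ × ℕ → Set
DecodesTo decode ds p = Σ (List ℕ) λ T → Sorted T × ds ↭ T × decode T ≡ p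

sorted-↭⇒≡ : ∀ {xs ys} → Sorted xs → Sorted ys → xs ↭ ys → xs ≡ ys
sorted-↭⇒≡ xs↗ ys↗ xs↭ys = Pointwise-≡⇒≡ (↗↭↗⇒≋ ≤-totalOrder xs↗ ys↗ (↭⇒↭ₛ xs↭ys))

module _ {N : ℕ} (W : List (Fin (suc N) × Fin (suc N))) (δ : ℕ → ℕ → List ℕ)
         (map-chebyshev≡δ : ∀ i j → map (chebyshev (i , j)) W ≡ δ (toℕ i) (toℕ j))
         (decode : List ℕ → ℕ × ℕ) (decodes : ∀ x y → x ≤ N → y ≤ N → DecodesTo decode (δ x y) (x , y))
         where

  decodable⇒resolving : Unique W → MultisetResolving (Grid (suc N) (suc N)) W
  decodable⇒resolving unique = unique , resolves
    where
    resolves : ∀ u v ds es → DistList (Grid (suc N) (suc N)) u W ds → DistList (Grid (suc N) (suc N)) v W es →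
               ds ↭ es → u ≡ v
    resolves (i , j) (k , l) ds es ds-dist es-dist ds↭es
      with decodes (toℕ i) (toℕ j) (toℕ≤pred[n] i) (toℕ≤pred[n] j)
         | decodes (toℕ k) (toℕ l) (toℕ≤pred[n] k) (toℕ≤pred[n] l)
    ... | T , T↗ , ij↭T , decodeT | U , U↗ , kl↭U , decodeU =
      cong₂ _,_ (toℕ-injective (cong proj₁ coordinates≡)) (toℕ-injective (cong proj₂ coordinates≡))
      where
      δ↭δ : δ (toℕ i) (toℕ j) ↭ δ (toℕ k) (toℕ l)
      δ↭δ = subst₂ _↭_ (trans (distList⇒≡map ds-dist) (map-chebyshev≡δ i j))
                       (trans (distList⇒≡map es-dist) (map-chebyshev≡δ k l)) ds↭es
      T≡U : T ≡ U
      T≡U = sorted-↭⇒≡ T↗ U↗ (↭-trans (↭-sym ij↭T) (↭-trans δ↭δ kl↭U))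
      coordinates≡ : (toℕ i , toℕ j) ≡ (toℕ k , toℕ l)
      coordinates≡ = trans (sym decodeT) (trans (cong decode T≡U) decodeU)

≡ᵇ-true : ∀ {m n} → m ≡ n → (m ≡ᵇ n) ≡ true
≡ᵇ-true {m} {n} = dec-true (m ≟ n)

≡ᵇ-false : ∀ {m n} → m ≢ n → (m ≡ᵇ n) ≡ false
≡ᵇ-false {m} {n} = dec-false (m ≟ n)

≤ᵇ-true : ∀ {m n} → m ≤ n → (m ≤ᵇ n) ≡ true
≤ᵇ-true {m} {n} = dec-true (m ≤? n)

≤ᵇ-false : ∀ {m n} → ¬ m ≤ n → (m ≤ᵇ n) ≡ false
≤ᵇ-false {m} {n} = dec-false (m ≤? n)

1+m+m≢n+n : ∀ m n → suc (m + m) ≢ n + n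
1+m+m≢n+n zero    zero    ()
1+m+m≢n+n zero    (suc n) eq with trans (suc-injective eq) (+-suc n n)
... | ()
1+m+m≢n+n (suc m) zero    ()
1+m+m≢n+n (suc m) (suc n) eq rewrite +-suc m m | +-suc n n =
  1+m+m≢n+n m n (suc-injective (suc-injective eq))

x+y<N⇒x<N∸y : ∀ {N} x y → x + y < N → x < N ∸ y
x+y<N⇒x<N∸y x y x+y<N = m+n≤o⇒m≤o∸n (suc x) x+y<N

x+y<N⇒y<N∸x : ∀ {N} x y → x + y < N → y < N ∸ x
x+y<N⇒y<N∸x {N} x y x+y<N = x+y<N⇒x<N∸y y x (subst (_< N) (+-comm x y) x+y<N)

x⊔[N∸y]≡N∸y : ∀ {N} x y → x + y < N → x ⊔ (N ∸ y) ≡ N ∸ y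
x⊔[N∸y]≡N∸y x y x+y<N = m≤n⇒m⊔n≡n (<⇒≤ (x+y<N⇒x<N∸y x y x+y<N))

[N∸x]⊔y≡N∸x : ∀ {N} x y → x + y < N → (N ∸ x) ⊔ y ≡ N ∸ x
[N∸x]⊔y≡N∸x x y x+y<N = m≥n⇒m⊔n≡m (<⇒≤ (x+y<N⇒y<N∸x x y x+y<N))

x⊔[N∸y]≡x : ∀ {N} x y → N ≤ x + y → x ⊔ (N ∸ y) ≡ x
x⊔[N∸y]≡x {N} x y N≤x+y = m≥n⇒m⊔n≡m (m≤n+o⇒m∸n≤o N y (subst (N ≤_) (+-comm x y) N≤x+y))

[N∸x]⊔y≡y : ∀ {N} x y → N ≤ x + y → (N ∸ x) ⊔ y ≡ y
[N∸x]⊔y≡y {N} x y N≤x+y = m≤n⇒m⊔n≡n (m≤n+o⇒m∸n≤o N x N≤x+y)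

∣y-1∣≤x : ∀ {x y} → y ≤ suc x → (y ≡ 0 → 1 ≤ x) → ∣ y - 1 ∣ ≤ x
∣y-1∣≤x {y = zero}  _         1≤x = 1≤x refl
∣y-1∣≤x {y = suc y} (s≤s y≤x) _   = subst (_≤ _) (sym (∣-∣-identityʳ y)) y≤x

entries-↭ : ∀ {a b c d a′ b′ c′ d′ : ℕ} {T} → a ≡ a′ → b ≡ b′ → c ≡ c′ → d ≡ d′ →
            (a′ ∷ b′ ∷ c′ ∷ d′ ∷ []) ↭ T → (a ∷ b ∷ c ∷ d ∷ []) ↭ T
entries-↭ refl refl refl refl p = p

swap₀₁ : ∀ {a b : ℕ} {t} → (a ∷ b ∷ t) ↭ (b ∷ a ∷ t)
swap₀₁ {a} {b} = ↭-swap a b ↭-refl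

swap₁₂ : ∀ {a b c : ℕ} {t} → (a ∷ b ∷ c ∷ t) ↭ (a ∷ c ∷ b ∷ t)
swap₁₂ {a} = ↭-prep a swap₀₁

swap₂₃ : ∀ {a b c d : ℕ} {t} → (a ∷ b ∷ c ∷ d ∷ t) ↭ (a ∷ b ∷ d ∷ c ∷ t)
swap₂₃ {a} = ↭-prep a swap₁₂

infixr 5 _⨾_
_⨾_ : ∀ {xs ys zs : List ℕ} → xs ↭ ys → ys ↭ zs → xs ↭ zs
_⨾_ = ↭-trans

reverse₄ : ∀ {a b c d : ℕ} → (a ∷ b ∷ c ∷ d ∷ []) ↭ (d ∷ c ∷ b ∷ a ∷ [])
reverse₄ = swap₀₁ ⨾ swap₁₂ ⨾ swap₂₃ ⨾ swap₀₁ ⨾ swap₁₂ ⨾ swap₀₁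

module Odd (h : ℕ) where

  N : ℕ
  N = h + h

  -- The distances from (x, y) to (0, N), (N, 0), (0, 0) and (0, 1).
  distances : ℕ → ℕ → List ℕ
  distances x y = (x ⊔ (N ∸ y)) ∷ ((N ∸ x) ⊔ y) ∷ (x ⊔ y) ∷ (x ⊔ ∣ y - 1 ∣) ∷ []

  -- In order, the branches recognise the sorted lists  y x x x,  x (y-1) y y,  x x (N-x) (N-x),
  -- 0 1 N N,  x x (N-x) (N-y),  (N-x) x x (N-y),  (N-y) (y-1) y (N-x)  and  (y-1) y (N-y) (N-x).
  decode : List ℕ → ℕ × ℕ
  decode (a ∷ b ∷ c ∷ d ∷ []) =
    if c ≡ᵇ d
    then (if b ≡ᵇ c then (d , a)
          else if suc b ≡ᵇ c then (a , d)
          else if a ≡ᵇ b then (a , a)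
          else (0 , 0))
    else (if a ≡ᵇ b then (a , N ∸ d)
          else if (b ≡ᵇ c) ∧ (a + b ≡ᵇ N) then (b , N ∸ d)
          else if c ≡ᵇ suc b then (N ∸ d , c)
          else (N ∸ d , b))
  decode _ = (0 , 0)


  module _ (a b c d : ℕ) where

    private
      D : ℕ × ℕ
      D = decode (a ∷ b ∷ c ∷ d ∷ [])

    decode-far-y≤x : c ≡ d → b ≡ c → D ≡ (d , a)
    decode-far-y≤x c≡d b≡c rewrite ≡ᵇ-true c≡d | ≡ᵇ-true b≡c = refl

    decode-far-x<y : c ≡ d → b ≢ c → suc b ≡ c → D ≡ (a , d)
    decode-far-x<y c≡d b≢c 1+b≡c rewrite ≡ᵇ-true c≡d | ≡ᵇ-false b≢c | ≡ᵇ-true 1+b≡c = refl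

    decode-diagonal : c ≡ d → b ≢ c → suc b ≢ c → a ≡ b → D ≡ (a , a)
    decode-diagonal c≡d b≢c 1+b≢c a≡b rewrite ≡ᵇ-true c≡d | ≡ᵇ-false b≢c | ≡ᵇ-false 1+b≢c | ≡ᵇ-true a≡b = refl

    decode-origin : c ≡ d → b ≢ c → suc b ≢ c → a ≢ b → D ≡ (0 , 0)
    decode-origin c≡d b≢c 1+b≢c a≢b rewrite ≡ᵇ-true c≡d | ≡ᵇ-false b≢c | ≡ᵇ-false 1+b≢c | ≡ᵇ-false a≢b = refl

    decode-near-y≤x-x+x≤N : c ≢ d → a ≡ b → D ≡ (a , N ∸ d)
    decode-near-y≤x-x+x≤N c≢d a≡b rewrite ≡ᵇ-false c≢d | ≡ᵇ-true a≡b = refl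

    decode-near-y≤x-N<x+x : c ≢ d → a ≢ b → b ≡ c → a + b ≡ N → D ≡ (b , N ∸ d)
    decode-near-y≤x-N<x+x c≢d a≢b b≡c a+b≡N rewrite ≡ᵇ-false c≢d | ≡ᵇ-false a≢b | ≡ᵇ-true b≡c | ≡ᵇ-true a+b≡N = refl

    decode-near-x<y-y+y≤N : c ≢ d → a ≢ b → a + b ≢ N → c ≢ suc b → D ≡ (N ∸ d , b)
    decode-near-x<y-y+y≤N c≢d a≢b a+b≢N c≢1+b
      rewrite ≡ᵇ-false c≢d | ≡ᵇ-false a≢b | ≡ᵇ-false a+b≢N | ∧-zeroʳ (b ≡ᵇ c) | ≡ᵇ-false c≢1+b = refl

    decode-near-x<y-N<y+y : c ≢ d → a ≢ b → b ≢ c → c ≡ suc b → D ≡ (N ∸ d , c)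
    decode-near-x<y-N<y+y c≢d a≢b b≢c c≡1+b rewrite ≡ᵇ-false c≢d | ≡ᵇ-false a≢b | ≡ᵇ-false b≢c | ≡ᵇ-true c≡1+b = refl

  Decodable : ℕ → ℕ → Set
  Decodable x y = DecodesTo decode (distances x y) (x , y)

  decodable-far-y≤x : ∀ x y → N ≤ x + y → y ≤ x → 1 ≤ x → Decodable x y
  decodable-far-y≤x x y N≤x+y y≤x 1≤x =
    (y ∷ x ∷ x ∷ x ∷ []) , y≤x ∷ ≤-refl ∷ ≤-refl ∷ [-] ,
    entries-↭ (x⊔[N∸y]≡x x _ N≤x+y) ([N∸x]⊔y≡y x _ N≤x+y) (m≥n⇒m⊔n≡m y≤x)
              (m≥n⇒m⊔n≡m (∣y-1∣≤x (m≤n⇒m≤1+n y≤x) λ _ → 1≤x)) swap₀₁ ,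
    decode-far-y≤x y x x x refl refl

  decodable-far-x<y : ∀ x y → N ≤ x + suc y → x ≤ y → Decodable x (suc y)
  decodable-far-x<y x y N≤x+y x≤y =
    (x ∷ y ∷ suc y ∷ suc y ∷ []) , x≤y ∷ n≤1+n y ∷ ≤-refl ∷ [-] ,
    entries-↭ (x⊔[N∸y]≡x x _ N≤x+y) ([N∸x]⊔y≡y x _ N≤x+y) (m≤n⇒m⊔n≡n (m≤n⇒m≤1+n x≤y))
              (trans (cong (x ⊔_) (∣-∣-identityʳ y)) (m≤n⇒m⊔n≡n x≤y)) (swap₂₃ ⨾ swap₁₂) ,
    decode-far-x<y x y (suc y) (suc y) refl (<⇒≢ (n<1+n y)) refl

  decodable-origin : 3 ≤ N → Decodable 0 0
  decodable-origin 3≤N =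
    (0 ∷ 1 ∷ N ∷ N ∷ []) , z≤n ∷ ≤-trans (s≤s z≤n) 3≤N ∷ ≤-refl ∷ [-] ,
    entries-↭ refl (⊔-identityʳ N) refl refl (swap₁₂ ⨾ swap₀₁ ⨾ swap₂₃ ⨾ swap₁₂) ,
    decode-origin 0 1 N N refl (<⇒≢ (≤-trans (s≤s (s≤s z≤n)) 3≤N)) (<⇒≢ 3≤N) (λ ())

  decodable-near-y≤x-x+x≤N : ∀ x y → x ≤ N → y ≤ N → x + y < N → y ≤ x → 1 ≤ x → x + x ≤ N → Decodable x y
  decodable-near-y≤x-x+x≤N x y x≤N y≤N x+y<N y≤x 1≤x x+x≤N =
    (x ∷ x ∷ N ∸ x ∷ N ∸ y ∷ []) , ≤-refl ∷ m+n≤o⇒m≤o∸n x x+x≤N ∷ ∸-monoʳ-≤ N y≤x ∷ [-] ,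
    entries-↭ (x⊔[N∸y]≡N∸y x _ x+y<N) ([N∸x]⊔y≡N∸x x _ x+y<N) (m≥n⇒m⊔n≡m y≤x)
              (m≥n⇒m⊔n≡m (∣y-1∣≤x (m≤n⇒m≤1+n y≤x) λ _ → 1≤x)) reverse₄ ,
    decodeT
    where
    decodeT : decode (x ∷ x ∷ N ∸ x ∷ N ∸ y ∷ []) ≡ (x , y)
    decodeT with x ≟ y
    ... | yes refl = decode-diagonal x x (N ∸ x) (N ∸ x) refl (<⇒≢ (x+y<N⇒x<N∸y x x x+y<N))
                       (λ 1+x≡N∸x → 1+m+m≢n+n x h (trans (cong (_+ x) 1+x≡N∸x) (m∸n+n≡m x≤N))) refl
    ... | no x≢y = trans (decode-near-y≤x-x+x≤N x x (N ∸ x) (N ∸ y) (x≢y ∘ ∸-cancelˡ-≡ x≤N y≤N) refl)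
                         (cong (x ,_) (m∸[m∸n]≡n y≤N))

  decodable-near-y≤x-N<x+x : ∀ x y → x ≤ N → y ≤ N → x + y < N → y ≤ x → N < x + x → Decodable x y
  decodable-near-y≤x-N<x+x x y x≤N y≤N x+y<N y≤x N<x+x =
    (N ∸ x ∷ x ∷ x ∷ N ∸ y ∷ []) , m≤n+o⇒m∸n≤o N x (<⇒≤ N<x+x) ∷ ≤-refl ∷ <⇒≤ x<N∸y ∷ [-] ,
    entries-↭ (x⊔[N∸y]≡N∸y x _ x+y<N) ([N∸x]⊔y≡N∸x x _ x+y<N) (m≥n⇒m⊔n≡m y≤x)
              (m≥n⇒m⊔n≡m (∣y-1∣≤x (m≤n⇒m≤1+n y≤x) λ _ → 1≤x)) (swap₀₁ ⨾ swap₁₂ ⨾ swap₂₃) ,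
    trans (decode-near-y≤x-N<x+x (N ∸ x) x x (N ∸ y) (<⇒≢ x<N∸y) N∸x≢x refl (m∸n+n≡m x≤N))
          (cong (x ,_) (m∸[m∸n]≡n y≤N))
    where
    x<N∸y : x < N ∸ y
    x<N∸y = x+y<N⇒x<N∸y x y x+y<N
    1≤x : 1 ≤ x
    1≤x = n≢0⇒n>0 λ { refl → n≮0 N<x+x }
    N∸x≢x : N ∸ x ≢ x
    N∸x≢x N∸x≡x = <-irrefl (trans (sym (m∸n+n≡m x≤N)) (cong (_+ x) N∸x≡x)) N<x+x

  decodable-near-x<y-y+y≤N : ∀ x y → x ≤ N → suc y ≤ N → x + suc y < N → x ≤ y → suc y + suc y ≤ N →
                             Decodable x (suc y)
  decodable-near-x<y-y+y≤N x y x≤N 1+y≤N x+y<N x≤y y+y≤N =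
    (y ∷ suc y ∷ N ∸ suc y ∷ N ∸ x ∷ []) ,
    n≤1+n y ∷ m+n≤o⇒m≤o∸n (suc y) y+y≤N ∷ ∸-monoʳ-≤ N (m≤n⇒m≤1+n x≤y) ∷ [-] ,
    entries-↭ (x⊔[N∸y]≡N∸y x _ x+y<N) ([N∸x]⊔y≡N∸x x _ x+y<N) (m≤n⇒m⊔n≡n (m≤n⇒m≤1+n x≤y))
              (trans (cong (x ⊔_) (∣-∣-identityʳ y)) (m≤n⇒m⊔n≡n x≤y)) (reverse₄ ⨾ swap₂₃) ,
    trans (decode-near-x<y-y+y≤N y (suc y) (N ∸ suc y) (N ∸ x)
             (λ e → <⇒≢ (s≤s x≤y) (sym (∸-cancelˡ-≡ 1+y≤N x≤N e))) (<⇒≢ (n<1+n y))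
             (λ e → 1+m+m≢n+n y h (trans (sym (+-suc y y)) e))
             (λ e → 1+m+m≢n+n (suc y) h (trans (sym (cong (_+ suc y) e)) (m∸n+n≡m 1+y≤N))))
          (cong (_, suc y) (m∸[m∸n]≡n x≤N))

  decodable-near-x<y-N<y+y : ∀ x y → x ≤ N → suc y ≤ N → x + suc y < N → x ≤ y → N < suc y + suc y →
                             Decodable x (suc y)
  decodable-near-x<y-N<y+y x y x≤N 1+y≤N x+y<N x≤y N<y+y =
    (N ∸ suc y ∷ y ∷ suc y ∷ N ∸ x ∷ []) ,
    m≤n+o⇒m∸n≤o N (suc y) (s≤s⁻¹ (subst (N <_) (+-suc (suc y) y) N<y+y)) ∷ n≤1+n y ∷ <⇒≤ y<N∸x ∷ [-] ,
    entries-↭ (x⊔[N∸y]≡N∸y x _ x+y<N) ([N∸x]⊔y≡N∸x x _ x+y<N) (m≤n⇒m⊔n≡n (m≤n⇒m≤1+n x≤y))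
              (trans (cong (x ⊔_) (∣-∣-identityʳ y)) (m≤n⇒m⊔n≡n x≤y)) (swap₁₂ ⨾ swap₂₃ ⨾ swap₁₂) ,
    trans (decode-near-x<y-N<y+y (N ∸ suc y) y (suc y) (N ∸ x) (<⇒≢ y<N∸x)
             (λ e → 1+m+m≢n+n y h (trans (sym (+-suc y y)) (trans (sym (cong (_+ suc y) e)) (m∸n+n≡m 1+y≤N))))
             (<⇒≢ (n<1+n y)) refl)
          (cong (_, suc y) (m∸[m∸n]≡n x≤N))
    where
    y<N∸x : suc y < N ∸ x
    y<N∸x = x+y<N⇒y<N∸x x (suc y) x+y<N

  decodable-far : 1 ≤ N → ∀ x y → N ≤ x + y → Decodable x y
  decodable-far 1≤N x y N≤x+y with y ≤? x
  decodable-far 1≤N x y       N≤x+y | yes y≤x = decodable-far-y≤x x y N≤x+y y≤x 1≤x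
    where
    1≤x : 1 ≤ x
    1≤x = n≢0⇒n>0 λ { refl → n≮0 (≤-trans 1≤N (≤-trans N≤x+y y≤x)) }
  decodable-far 1≤N x zero    N≤x+y | no 0≰x  = ⊥-elim (0≰x z≤n)
  decodable-far 1≤N x (suc y) N≤x+y | no y≰x  = decodable-far-x<y x y N≤x+y (s≤s⁻¹ (≰⇒> y≰x))

  decodable-near-y≤x : ∀ x y → x ≤ N → y ≤ N → x + y < N → y ≤ x → 1 ≤ x → Decodable x y
  decodable-near-y≤x x y x≤N y≤N x+y<N y≤x 1≤x with x + x ≤? N
  ... | yes x+x≤N = decodable-near-y≤x-x+x≤N x y x≤N y≤N x+y<N y≤x 1≤x x+x≤N
  ... | no x+x≰N  = decodable-near-y≤x-N<x+x x y x≤N y≤N x+y<N y≤x (≰⇒> x+x≰N)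

  decodable-near-x<y : ∀ x y → x ≤ N → suc y ≤ N → x + suc y < N → x ≤ y → Decodable x (suc y)
  decodable-near-x<y x y x≤N y≤N x+y<N x≤y with suc y + suc y ≤? N
  ... | yes y+y≤N = decodable-near-x<y-y+y≤N x y x≤N y≤N x+y<N x≤y y+y≤N
  ... | no y+y≰N  = decodable-near-x<y-N<y+y x y x≤N y≤N x+y<N x≤y (≰⇒> y+y≰N)

  decodable-near : 3 ≤ N → ∀ x y → x ≤ N → y ≤ N → x + y < N → Decodable x y
  decodable-near 3≤N zero    zero    _   _   _     = decodable-origin 3≤N
  decodable-near 3≤N zero    (suc y) x≤N y≤N x+y<N = decodable-near-x<y 0 y x≤N y≤N x+y<N z≤n
  decodable-near 3≤N (suc x) zero    x≤N y≤N x+y<N = decodable-near-y≤x (suc x) 0 x≤N y≤N x+y<N z≤n (s≤s z≤n)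
  decodable-near 3≤N (suc x) (suc y) x≤N y≤N x+y<N with suc y ≤? suc x
  ... | yes y≤x = decodable-near-y≤x (suc x) (suc y) x≤N y≤N x+y<N y≤x (s≤s z≤n)
  ... | no y≰x  = decodable-near-x<y (suc x) y x≤N y≤N x+y<N (s≤s⁻¹ (≰⇒> y≰x))

  decodable : 3 ≤ N → ∀ x y → x ≤ N → y ≤ N → Decodable x y
  decodable 3≤N x y x≤N y≤N with N ≤? x + y
  ... | yes far  = decodable-far (≤-trans (s≤s z≤n) 3≤N) x y far
  ... | no  near = decodable-near 3≤N x y x≤N y≤N (≰⇒> near)

module Even (h : ℕ) where

  N : ℕ
  N = suc (h + h)

  -- The distances from (x, y) to (0, N), (N, 0), (0, 1) and (1, 1).
  distances : ℕ → ℕ → List ℕ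
  distances x y = (x ⊔ (N ∸ y)) ∷ ((N ∸ x) ⊔ y) ∷ (x ⊔ ∣ y - 1 ∣) ∷ (∣ x - 1 ∣ ⊔ ∣ y - 1 ∣) ∷ []

  -- In order, the branches recognise the sorted lists  (x-1) x x x,  y (x-1) x x,  (x-1) x (N-x) (N-x),  1 1 N N,
  -- x (y-1) (y-1) y,  (y-1) (y-1) (N-y) (N-x) or (N-y) (y-1) (y-1) (N-x),  1 1 (N-1) N,  (N-x) (x-1) x (N-y),
  -- (y-1) (y-1) (N-y) (N-x),  0 1 (N-1) N,  (x-1) x (N-x) (N-y)  and  (N-x) (x-1) x (N-y).
  decode : List ℕ → ℕ × ℕ
  decode (a ∷ b ∷ c ∷ d ∷ []) =
    if c ≡ᵇ d
    then (if b ≡ᵇ c then (d , d)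
          else if (N ≤ᵇ a + d) ∧ (suc b ≡ᵇ c) then (d , a)
          else if suc a ≡ᵇ b then (b , b)
          else (0 , 0))
    else (if b ≡ᵇ c then (if d ≡ᵇ suc c then (a , d) else (N ∸ d , suc b))
          else if a ≡ᵇ b then (if a + c ≡ᵇ N then (if a ≡ᵇ 1 then (1 , 0) else (c , N ∸ d)) else (N ∸ d , suc a))
          else if b ≡ᵇ suc a then (if a ≡ᵇ 0 then (0 , 1) else (b , N ∸ d))
          else (c , N ∸ d))
  decode _ = (0 , 0)

  module _ (a b c d : ℕ) where

    private
      D : ℕ × ℕ
      D = decode (a ∷ b ∷ c ∷ d ∷ [])

    decode-far-x≡y : c ≡ d → b ≡ c → D ≡ (d , d)
    decode-far-x≡y c≡d b≡c rewrite ≡ᵇ-true c≡d | ≡ᵇ-true b≡c = refl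

    decode-far-y<x : c ≡ d → b ≢ c → N ≤ a + d → suc b ≡ c → D ≡ (d , a)
    decode-far-y<x c≡d b≢c far 1+b≡c rewrite ≡ᵇ-true c≡d | ≡ᵇ-false b≢c | ≤ᵇ-true far | ≡ᵇ-true 1+b≡c = refl

    decode-near-x≡y : c ≡ d → b ≢ c → ¬ N ≤ a + d → suc a ≡ b → D ≡ (b , b)
    decode-near-x≡y c≡d b≢c near 1+a≡b rewrite ≡ᵇ-true c≡d | ≡ᵇ-false b≢c | ≤ᵇ-false near | ≡ᵇ-true 1+a≡b = refl

    decode-origin : c ≡ d → b ≢ c → suc b ≢ c → suc a ≢ b → D ≡ (0 , 0)
    decode-origin c≡d b≢c 1+b≢c 1+a≢b
      rewrite ≡ᵇ-true c≡d | ≡ᵇ-false b≢c | ≡ᵇ-false 1+b≢c | ∧-zeroʳ (N ≤ᵇ a + d) | ≡ᵇ-false 1+a≢b = refl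

    decode-far-x<y : c ≢ d → b ≡ c → d ≡ suc c → D ≡ (a , d)
    decode-far-x<y c≢d b≡c d≡1+c rewrite ≡ᵇ-false c≢d | ≡ᵇ-true b≡c | ≡ᵇ-true d≡1+c = refl

    decode-near-x<y-b≡c : c ≢ d → b ≡ c → d ≢ suc c → D ≡ (N ∸ d , suc b)
    decode-near-x<y-b≡c c≢d b≡c d≢1+c rewrite ≡ᵇ-false c≢d | ≡ᵇ-true b≡c | ≡ᵇ-false d≢1+c = refl

    decode-1-0 : c ≢ d → b ≢ c → a ≡ b → a + c ≡ N → a ≡ 1 → D ≡ (1 , 0)
    decode-1-0 c≢d b≢c a≡b a+c≡N a≡1 rewrite ≡ᵇ-false c≢d | ≡ᵇ-false b≢c | ≡ᵇ-true a≡b | ≡ᵇ-true a+c≡N | ≡ᵇ-true a≡1 = refl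

    decode-near-y≤x-a+c≡N : c ≢ d → b ≢ c → a ≡ b → a + c ≡ N → a ≢ 1 → D ≡ (c , N ∸ d)
    decode-near-y≤x-a+c≡N c≢d b≢c a≡b a+c≡N a≢1
      rewrite ≡ᵇ-false c≢d | ≡ᵇ-false b≢c | ≡ᵇ-true a≡b | ≡ᵇ-true a+c≡N | ≡ᵇ-false a≢1 = refl

    decode-near-x<y-a≡b : c ≢ d → b ≢ c → a ≡ b → a + c ≢ N → D ≡ (N ∸ d , suc a)
    decode-near-x<y-a≡b c≢d b≢c a≡b a+c≢N rewrite ≡ᵇ-false c≢d | ≡ᵇ-false b≢c | ≡ᵇ-true a≡b | ≡ᵇ-false a+c≢N = refl

    decode-0-1 : c ≢ d → b ≢ c → a ≢ b → b ≡ suc a → a ≡ 0 → D ≡ (0 , 1)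
    decode-0-1 c≢d b≢c a≢b b≡1+a a≡0 rewrite ≡ᵇ-false c≢d | ≡ᵇ-false b≢c | ≡ᵇ-false a≢b | ≡ᵇ-true b≡1+a | ≡ᵇ-true a≡0 = refl

    decode-near-y≤x-b≡1+a : c ≢ d → b ≢ c → a ≢ b → b ≡ suc a → a ≢ 0 → D ≡ (b , N ∸ d)
    decode-near-y≤x-b≡1+a c≢d b≢c a≢b b≡1+a a≢0
      rewrite ≡ᵇ-false c≢d | ≡ᵇ-false b≢c | ≡ᵇ-false a≢b | ≡ᵇ-true b≡1+a | ≡ᵇ-false a≢0 = refl

    decode-near-y≤x-b≢1+a : c ≢ d → b ≢ c → a ≢ b → b ≢ suc a → D ≡ (c , N ∸ d)
    decode-near-y≤x-b≢1+a c≢d b≢c a≢b b≢1+a rewrite ≡ᵇ-false c≢d | ≡ᵇ-false b≢c | ≡ᵇ-false a≢b | ≡ᵇ-false b≢1+a = refl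

  Decodable : ℕ → ℕ → Set
  Decodable x y = DecodesTo decode (distances x y) (x , y)

  decodable-far-y<x : ∀ x y → N ≤ suc x + y → y ≤ x → 1 ≤ x → Decodable (suc x) y
  decodable-far-y<x x y far y≤x 1≤x =
    (y ∷ x ∷ suc x ∷ suc x ∷ []) , y≤x ∷ n≤1+n x ∷ ≤-refl ∷ [-] ,
    entries-↭ (x⊔[N∸y]≡x (suc x) y far) ([N∸x]⊔y≡y (suc x) y far)
              (m≥n⇒m⊔n≡m (∣y-1∣≤x (m≤n⇒m≤1+n (m≤n⇒m≤1+n y≤x)) λ _ → s≤s z≤n))
              (trans (cong (_⊔ ∣ y - 1 ∣) (∣-∣-identityʳ x)) (m≥n⇒m⊔n≡m (∣y-1∣≤x (m≤n⇒m≤1+n y≤x) λ _ → 1≤x)))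
              (swap₀₁ ⨾ swap₂₃ ⨾ swap₁₂) ,
    decode-far-y<x y x (suc x) (suc x) refl (<⇒≢ (n<1+n x)) (subst (N ≤_) (+-comm (suc x) y) far) refl

  decodable-far-x≡y : ∀ x → N ≤ suc x + suc x → Decodable (suc x) (suc x)
  decodable-far-x≡y x far =
    (x ∷ suc x ∷ suc x ∷ suc x ∷ []) , n≤1+n x ∷ ≤-refl ∷ ≤-refl ∷ [-] ,
    entries-↭ (x⊔[N∸y]≡x (suc x) (suc x) far) ([N∸x]⊔y≡y (suc x) (suc x) far)
              (trans (cong (suc x ⊔_) (∣-∣-identityʳ x)) (m≥n⇒m⊔n≡m (n≤1+n x)))
              (trans (cong₂ _⊔_ (∣-∣-identityʳ x) (∣-∣-identityʳ x)) (⊔-idem x)) reverse₄ ,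
    decode-far-x≡y x (suc x) (suc x) (suc x) refl refl

  decodable-far-x<y : ∀ x y → N ≤ x + suc y → x ≤ y → 1 ≤ y → Decodable x (suc y)
  decodable-far-x<y x y far x≤y 1≤y =
    (x ∷ y ∷ y ∷ suc y ∷ []) , x≤y ∷ ≤-refl ∷ n≤1+n y ∷ [-] ,
    entries-↭ (x⊔[N∸y]≡x x (suc y) far) ([N∸x]⊔y≡y x (suc y) far)
              (trans (cong (x ⊔_) (∣-∣-identityʳ y)) (m≤n⇒m⊔n≡n x≤y))
              (trans (cong (∣ x - 1 ∣ ⊔_) (∣-∣-identityʳ y)) (m≤n⇒m⊔n≡n (∣y-1∣≤x (m≤n⇒m≤1+n x≤y) λ _ → 1≤y)))
              (swap₁₂ ⨾ swap₂₃) ,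
    decode-far-x<y x y y (suc y) (<⇒≢ (n<1+n y)) refl refl

  decodable-near-y≤x-x+x<N : ∀ x y → suc x ≤ N → y ≤ N → suc x + y < N → y ≤ suc x → suc x + suc x < N →
                             (y ≡ 0 → 1 ≤ x) → Decodable (suc x) y
  decodable-near-y≤x-x+x<N x y x≤N y≤N x+y<N y≤x x+x<N y≡0⇒1≤x =
    (x ∷ suc x ∷ N ∸ suc x ∷ N ∸ y ∷ []) , n≤1+n x ∷ m+n≤o⇒m≤o∸n (suc x) (<⇒≤ x+x<N) ∷ ∸-monoʳ-≤ N y≤x ∷ [-] ,
    entries-↭ (x⊔[N∸y]≡N∸y (suc x) y x+y<N) ([N∸x]⊔y≡N∸x (suc x) y x+y<N)
              (m≥n⇒m⊔n≡m (∣y-1∣≤x (m≤n⇒m≤1+n y≤x) λ _ → s≤s z≤n))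
              (trans (cong (_⊔ ∣ y - 1 ∣) (∣-∣-identityʳ x)) (m≥n⇒m⊔n≡m (∣y-1∣≤x y≤x y≡0⇒1≤x))) reverse₄ ,
    decodeT
    where
    x<N∸x : suc x < N ∸ suc x
    x<N∸x = x+y<N⇒x<N∸y (suc x) (suc x) x+x<N
    decodeT : decode (x ∷ suc x ∷ N ∸ suc x ∷ N ∸ y ∷ []) ≡ (suc x , y)
    decodeT with suc x ≟ y
    ... | yes refl = decode-near-x≡y x (suc x) (N ∸ suc x) (N ∸ suc x) refl (<⇒≢ x<N∸x)
                       (λ far → <-irrefl refl (≤-trans (s≤s far) (≤-reflexive (m+[n∸m]≡n x≤N)))) refl
    ... | no x≢y = trans (decode-near-y≤x-b≡1+a x (suc x) (N ∸ suc x) (N ∸ y) (x≢y ∘ ∸-cancelˡ-≡ x≤N y≤N)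
                           (<⇒≢ x<N∸x) (<⇒≢ (n<1+n x)) refl x≢0)
                         (cong (suc x ,_) (m∸[m∸n]≡n y≤N))
      where
      x≢0 : x ≢ 0
      x≢0 refl = x≢y (≤-antisym (n≢0⇒n>0 (1+n≰n ∘ y≡0⇒1≤x)) y≤x)

  decodable-near-y≤x-N<x+x : 4 ≤ N → ∀ x y → suc x ≤ N → y ≤ N → suc x + y < N → y ≤ suc x → N < suc x + suc x →
                             1 ≤ x → Decodable (suc x) y
  decodable-near-y≤x-N<x+x 4≤N x y x≤N y≤N x+y<N y≤x N<x+x 1≤x =
    (N ∸ suc x ∷ x ∷ suc x ∷ N ∸ y ∷ []) , N∸x≤x ∷ n≤1+n x ∷ <⇒≤ x<N∸y ∷ [-] ,
    entries-↭ (x⊔[N∸y]≡N∸y (suc x) y x+y<N) ([N∸x]⊔y≡N∸x (suc x) y x+y<N)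
              (m≥n⇒m⊔n≡m (∣y-1∣≤x (m≤n⇒m≤1+n y≤x) λ _ → s≤s z≤n))
              (trans (cong (_⊔ ∣ y - 1 ∣) (∣-∣-identityʳ x)) (m≥n⇒m⊔n≡m (∣y-1∣≤x y≤x λ _ → 1≤x)))
              (swap₀₁ ⨾ swap₁₂ ⨾ swap₂₃ ⨾ swap₁₂) ,
    decodeT
    where
    a : ℕ
    a = N ∸ suc x
    N∸x≤x : a ≤ x
    N∸x≤x = m≤n+o⇒m∸n≤o N (suc x) (subst (N ≤_) (+-suc x x) (s≤s⁻¹ N<x+x))
    x<N∸y : suc x < N ∸ y
    x<N∸y = x+y<N⇒x<N∸y (suc x) y x+y<N
    decodeT : decode (a ∷ x ∷ suc x ∷ N ∸ y ∷ []) ≡ (suc x , y)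
    decodeT with a ≟ x
    ... | yes a≡x = trans (decode-near-y≤x-a+c≡N a x (suc x) (N ∸ y) (<⇒≢ x<N∸y) (<⇒≢ (n<1+n x)) a≡x (m∸n+n≡m x≤N) a≢1)
                          (cong (suc x ,_) (m∸[m∸n]≡n y≤N))
      where
      a≢1 : a ≢ 1
      a≢1 a≡1 with trans (sym a≡x) a≡1
      ... | refl = <⇒≱ N<x+x 4≤N
    ... | no a≢x = trans (decode-near-y≤x-b≢1+a a x (suc x) (N ∸ y) (<⇒≢ x<N∸y) (<⇒≢ (n<1+n x)) a≢x x≢1+a)
                         (cong (suc x ,_) (m∸[m∸n]≡n y≤N))
      where
      x≢1+a : x ≢ suc a
      x≢1+a x≡1+a = 1+m+m≢n+n a h (suc-injective (sym (begin
        N                  ≡⟨ m∸n+n≡m x≤N ⟨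
        a + suc x          ≡⟨ cong (λ t → a + suc t) x≡1+a ⟩
        a + suc (suc a)    ≡⟨ +-suc a (suc a) ⟩
        suc (a + suc a)    ≡⟨ cong suc (+-suc a a) ⟩
        suc (suc (a + a))  ∎)))
        where open ≡-Reasoning

  decodable-near-x<y-y+y≤1+N : ∀ x y → x ≤ N → suc y ≤ N → x + suc y < N → x ≤ y → suc y + suc y ≤ suc N →
                               (x ≡ 0 → 1 ≤ y) → Decodable x (suc y)
  decodable-near-x<y-y+y≤1+N x y x≤N y≤N x+y<N x≤y y+y≤1+N x≡0⇒1≤y =
    (y ∷ y ∷ N ∸ suc y ∷ N ∸ x ∷ []) , ≤-refl ∷ m+n≤o⇒m≤o∸n y (s≤s⁻¹ y+y≤1+N) ∷ ∸-monoʳ-≤ N (m≤n⇒m≤1+n x≤y) ∷ [-] ,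
    entries-↭ (x⊔[N∸y]≡N∸y x (suc y) x+y<N) ([N∸x]⊔y≡N∸x x (suc y) x+y<N)
              (trans (cong (x ⊔_) (∣-∣-identityʳ y)) (m≤n⇒m⊔n≡n x≤y))
              (trans (cong (∣ x - 1 ∣ ⊔_) (∣-∣-identityʳ y)) (m≤n⇒m⊔n≡n (∣y-1∣≤x (m≤n⇒m≤1+n x≤y) x≡0⇒1≤y)))
              (swap₁₂ ⨾ swap₀₁ ⨾ swap₂₃ ⨾ swap₁₂) ,
    decodeT
    where
    N∸y≢N∸x : N ∸ suc y ≢ N ∸ x
    N∸y≢N∸x e = <⇒≢ (s≤s x≤y) (sym (∸-cancelˡ-≡ y≤N x≤N e))
    decodeT : decode (y ∷ y ∷ N ∸ suc y ∷ N ∸ x ∷ []) ≡ (x , suc y)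
    decodeT with y ≟ N ∸ suc y
    ... | yes y≡N∸y = trans (decode-near-x<y-b≡c y y (N ∸ suc y) (N ∸ x) N∸y≢N∸x y≡N∸y N∸x≢1+N∸y)
                            (cong (_, suc y) (m∸[m∸n]≡n x≤N))
      where
      N∸x≢1+N∸y : N ∸ x ≢ suc (N ∸ suc y)
      N∸x≢1+N∸y e = <⇒≢ x+y<N
        (trans (+-comm x (suc y)) (trans (cong (_+ x) (trans (cong suc y≡N∸y) (sym e))) (m∸n+n≡m x≤N)))
    ... | no y≢N∸y = trans (decode-near-x<y-a≡b y y (N ∸ suc y) (N ∸ x) N∸y≢N∸x y≢N∸y refl y+N∸y≢N)
                           (cong (_, suc y) (m∸[m∸n]≡n x≤N))
      where
      y+N∸y≢N : y + (N ∸ suc y) ≢ N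
      y+N∸y≢N e = <-irrefl refl
        (subst (_< N) e (<-≤-trans (+-monoˡ-< (N ∸ suc y) (n<1+n y)) (≤-reflexive (m+[n∸m]≡n y≤N))))

  decodable-near-x<y-1+N<y+y : ∀ x y → x ≤ N → x + suc y < N → x ≤ y → suc N < suc y + suc y →
                               (x ≡ 0 → 1 ≤ y) → Decodable x (suc y)
  decodable-near-x<y-1+N<y+y x y x≤N x+y<N x≤y 1+N<y+y x≡0⇒1≤y =
    (N ∸ suc y ∷ y ∷ y ∷ N ∸ x ∷ []) , N∸y≤y ∷ ≤-refl ∷ ≤-trans (n≤1+n y) (<⇒≤ y<N∸x) ∷ [-] ,
    entries-↭ (x⊔[N∸y]≡N∸y x (suc y) x+y<N) ([N∸x]⊔y≡N∸x x (suc y) x+y<N)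
              (trans (cong (x ⊔_) (∣-∣-identityʳ y)) (m≤n⇒m⊔n≡n x≤y))
              (trans (cong (∣ x - 1 ∣ ⊔_) (∣-∣-identityʳ y)) (m≤n⇒m⊔n≡n (∣y-1∣≤x (m≤n⇒m≤1+n x≤y) x≡0⇒1≤y)))
              (swap₁₂ ⨾ swap₂₃) ,
    trans (decode-near-x<y-b≡c (N ∸ suc y) y y (N ∸ x) (<⇒≢ (<-trans (n<1+n y) y<N∸x)) refl N∸x≢1+y)
          (cong (_, suc y) (m∸[m∸n]≡n x≤N))
    where
    y<N∸x : suc y < N ∸ x
    y<N∸x = x+y<N⇒y<N∸x x (suc y) x+y<N
    N∸y≤y : N ∸ suc y ≤ y
    N∸y≤y = m≤n+o⇒m∸n≤o N (suc y) (<⇒≤ (subst (N <_) (+-suc y y) (s≤s⁻¹ 1+N<y+y)))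
    N∸x≢1+y : N ∸ x ≢ suc y
    N∸x≢1+y e = <⇒≢ x+y<N (trans (+-comm x (suc y)) (trans (cong (_+ x) (sym e)) (m∸n+n≡m x≤N)))

  decodable-origin : 3 ≤ N → Decodable 0 0
  decodable-origin 3≤N =
    (1 ∷ 1 ∷ N ∷ N ∷ []) , ≤-refl ∷ s≤s z≤n ∷ ≤-refl ∷ [-] ,
    swap₁₂ ⨾ swap₀₁ ⨾ swap₂₃ ⨾ swap₁₂ ,
    decode-origin 1 1 N N refl (<⇒≢ (≤-trans (s≤s (s≤s z≤n)) 3≤N)) (<⇒≢ 3≤N) (λ ())

  decodable-1-0 : 3 ≤ N → Decodable 1 0
  decodable-1-0 3≤N =
    (1 ∷ 1 ∷ h + h ∷ N ∷ []) , ≤-refl ∷ s≤s⁻¹ (≤-trans (s≤s (s≤s z≤n)) 3≤N) ∷ n≤1+n (h + h) ∷ [-] ,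
    entries-↭ refl (⊔-identityʳ (h + h)) refl refl reverse₄ ,
    decode-1-0 1 1 (h + h) N (<⇒≢ (n<1+n (h + h))) (<⇒≢ (s≤s⁻¹ 3≤N)) refl refl refl

  decodable-0-1 : 3 ≤ N → Decodable 0 1
  decodable-0-1 3≤N =
    (0 ∷ 1 ∷ h + h ∷ N ∷ []) , z≤n ∷ s≤s⁻¹ (≤-trans (s≤s (s≤s z≤n)) 3≤N) ∷ n≤1+n (h + h) ∷ [-] ,
    entries-↭ refl (cong suc (⊔-identityʳ (h + h))) refl refl (swap₁₂ ⨾ swap₀₁ ⨾ swap₂₃ ⨾ swap₁₂) ,
    decode-0-1 0 1 (h + h) N (<⇒≢ (n<1+n (h + h))) (<⇒≢ (s≤s⁻¹ 3≤N)) (λ ()) refl refl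

  decodable-far : 2 ≤ N → ∀ x y → N ≤ x + y → Decodable x y
  decodable-far 2≤N zero    zero    N≤0 = ⊥-elim (n≮0 (≤-trans 2≤N N≤0))
  decodable-far 2≤N (suc x) zero    far =
    decodable-far-y<x x 0 far z≤n (n≢0⇒n>0 λ { refl → 1+n≰n (≤-trans 2≤N far) })
  decodable-far 2≤N zero    (suc y) far =
    decodable-far-x<y 0 y far z≤n (n≢0⇒n>0 λ { refl → 1+n≰n (≤-trans 2≤N far) })
  decodable-far 2≤N (suc x) (suc y) far with <-cmp x y
  ... | tri< x<y _ _  = decodable-far-x<y (suc x) y far x<y (≤-trans (s≤s z≤n) x<y)
  ... | tri≈ _ refl _ = decodable-far-x≡y x far
  ... | tri> _ _ y<x  = decodable-far-y<x x (suc y) far y<x (≤-trans (s≤s z≤n) y<x)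

  decodable-near-y≤x : 4 ≤ N → ∀ x y → suc x ≤ N → y ≤ N → suc x + y < N → y ≤ suc x → (y ≡ 0 → 1 ≤ x) →
                       Decodable (suc x) y
  decodable-near-y≤x 4≤N x y x≤N y≤N x+y<N y≤x y≡0⇒1≤x with suc x + suc x <? N
  ... | yes x+x<N = decodable-near-y≤x-x+x<N x y x≤N y≤N x+y<N y≤x x+x<N y≡0⇒1≤x
  ... | no x+x≮N  = decodable-near-y≤x-N<x+x 4≤N x y x≤N y≤N x+y<N y≤x N<x+x
                      (n≢0⇒n>0 λ { refl → <⇒≱ N<x+x (≤-trans (s≤s (s≤s z≤n)) 4≤N) })
    where
    N<x+x : N < suc x + suc x
    N<x+x = ≤∧≢⇒< (≮⇒≥ x+x≮N) λ N≡x+x → 1+m+m≢n+n x h (sym (suc-injective (trans N≡x+x (cong suc (+-suc x x)))))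

  decodable-near-x<y : ∀ x y → x ≤ N → suc y ≤ N → x + suc y < N → x ≤ y → (x ≡ 0 → 1 ≤ y) → Decodable x (suc y)
  decodable-near-x<y x y x≤N y≤N x+y<N x≤y x≡0⇒1≤y with suc y + suc y ≤? suc N
  ... | yes y+y≤1+N = decodable-near-x<y-y+y≤1+N x y x≤N y≤N x+y<N x≤y y+y≤1+N x≡0⇒1≤y
  ... | no y+y≰1+N  = decodable-near-x<y-1+N<y+y x y x≤N x+y<N x≤y (≰⇒> y+y≰1+N) x≡0⇒1≤y

  decodable-near : 4 ≤ N → ∀ x y → x ≤ N → y ≤ N → x + y < N → Decodable x y
  decodable-near 4≤N zero          zero          _   _   _     = decodable-origin (≤-trans (n≤1+n 3) 4≤N)
  decodable-near 4≤N (suc zero)    zero          _   _   _     = decodable-1-0 (≤-trans (n≤1+n 3) 4≤N)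
  decodable-near 4≤N zero          (suc zero)    _   _   _     = decodable-0-1 (≤-trans (n≤1+n 3) 4≤N)
  decodable-near 4≤N zero          (suc (suc y)) x≤N y≤N x+y<N =
    decodable-near-x<y 0 (suc y) x≤N y≤N x+y<N z≤n (λ _ → s≤s z≤n)
  decodable-near 4≤N (suc (suc x)) zero          x≤N y≤N x+y<N =
    decodable-near-y≤x 4≤N (suc x) 0 x≤N y≤N x+y<N z≤n (λ _ → s≤s z≤n)
  decodable-near 4≤N (suc x)       (suc y)       x≤N y≤N x+y<N with suc y ≤? suc x
  ... | yes y≤x = decodable-near-y≤x 4≤N x (suc y) x≤N y≤N x+y<N y≤x (λ ())
  ... | no y≰x  = decodable-near-x<y (suc x) y x≤N y≤N x+y<N (s≤s⁻¹ (≰⇒> y≰x)) (λ ())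

  decodable : 4 ≤ N → ∀ x y → x ≤ N → y ≤ N → Decodable x y
  decodable 4≤N x y x≤N y≤N with N ≤? x + y
  ... | yes far  = decodable-far (≤-trans (s≤s (s≤s z≤n)) 4≤N) x y far
  ... | no  near = decodable-near 4≤N x y x≤N y≤N (≰⇒> near)

-- Matching on 2 ≤ h exposes enough successors in N for the four landmarks to be distinct by (λ ()).
dimMs≤4-odd : ∀ h → 2 ≤ h → DimMsAtMost (PnPn (suc (h + h))) 4
dimMs≤4-odd h 2≤h@(s≤s (s≤s _)) =
  W , decodable⇒resolving W distances map-chebyshev≡distances decode (decodable 3≤N) unique , ≤-refl
  where
  open Odd h
  3≤N : 3 ≤ N
  3≤N = ≤-trans (n≤1+n 3) (+-mono-≤ 2≤h 2≤h)
  W : List (Fin (suc N) × Fin (suc N))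
  W = (zero , fromℕ N) ∷ (fromℕ N , zero) ∷ (zero , zero) ∷ (zero , suc zero) ∷ []
  unique : Unique W
  unique = ((λ ()) ∷ (λ ()) ∷ (λ ()) ∷ []) ∷ ((λ ()) ∷ (λ ()) ∷ []) ∷ ((λ ()) ∷ []) ∷ [] ∷ []
  map-chebyshev≡distances : ∀ i j → map (chebyshev (i , j)) W ≡ distances (toℕ i) (toℕ j)
  map-chebyshev≡distances i j rewrite toℕ-fromℕ N | ∣-∣-identityʳ (toℕ i) | ∣-∣-identityʳ (toℕ j)
    | m≤n⇒∣m-n∣≡n∸m (toℕ≤pred[n] i) | m≤n⇒∣m-n∣≡n∸m (toℕ≤pred[n] j) = refl

dimMs≤4-even : ∀ h → 2 ≤ h → DimMsAtMost (PnPn (suc (suc (h + h)))) 4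
dimMs≤4-even h 2≤h@(s≤s (s≤s _)) =
  W , decodable⇒resolving W distances map-chebyshev≡distances decode (decodable 4≤N) unique , ≤-refl
  where
  open Even h
  4≤N : 4 ≤ N
  4≤N = m≤n⇒m≤1+n (+-mono-≤ 2≤h 2≤h)
  W : List (Fin (suc N) × Fin (suc N))
  W = (zero , fromℕ N) ∷ (fromℕ N , zero) ∷ (zero , suc zero) ∷ (suc zero , suc zero) ∷ []
  unique : Unique W
  unique = ((λ ()) ∷ (λ ()) ∷ (λ ()) ∷ []) ∷ ((λ ()) ∷ (λ ()) ∷ []) ∷ ((λ ()) ∷ []) ∷ [] ∷ []
  map-chebyshev≡distances : ∀ i j → map (chebyshev (i , j)) W ≡ distances (toℕ i) (toℕ j)
  map-chebyshev≡distances i j rewrite toℕ-fromℕ N | ∣-∣-identityʳ (toℕ i) | ∣-∣-identityʳ (toℕ j)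
    | m≤n⇒∣m-n∣≡n∸m (toℕ≤pred[n] i) | m≤n⇒∣m-n∣≡n∸m (toℕ≤pred[n] j) = refl

halves : ∀ n → Σ ℕ λ h → n ≡ h + h ⊎ n ≡ suc (h + h)
halves zero = 0 , inj₁ refl
halves (suc n) with halves n
... | h , inj₁ n≡h+h   = h , inj₂ (cong suc n≡h+h)
... | h , inj₂ n≡1+h+h = suc h , inj₁ (trans (cong suc n≡1+h+h) (cong suc (sym (+-suc h h))))

3≤h+h⇒2≤h : ∀ h → 3 ≤ h + h → 2 ≤ h
3≤h+h⇒2≤h (suc (suc _)) _ = s≤s (s≤s z≤n)
3≤h+h⇒2≤h (suc zero) (s≤s (s≤s ()))

dimMs≤4 : ∀ n → 5 ≤ n → DimMsAtMost (PnPn n) 4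
dimMs≤4 (suc m) (s≤s 4≤m) with halves m
... | h , inj₁ refl = dimMs≤4-odd h (3≤h+h⇒2≤h h (≤-trans (n≤1+n 3) 4≤m))
... | h , inj₂ refl = dimMs≤4-even h (3≤h+h⇒2≤h h (s≤s⁻¹ 4≤m))

theorem6 : (n : ℕ) → 7 ≤ n → DimMsAtLeast (PnPn n) 3 × DimMsAtMost (PnPn n) 4
theorem6 n 7≤n = dimMs≥3 (≤-trans (m≤m+n 2 5) 7≤n) , dimMs≤4 n (≤-trans (m≤m+n 5 2) 7≤n)
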